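{- Suppose that $\mathfrak{BP}(d,\underline{C};\underline{w})$ is $1$-feasible and $W^{min}>C_1$, and fix a positive integer $N$. If $$d\geq n\cdot N+n\cdot(n-1)\cdot w_1\cdot|\underline{w}|,$$ then there exists a $1$-feasible partition $\mathcal{B}_\bullet$ with $w(\mathcal{B}_1)=W^{min}$ and $n_1(\mathcal{B}_1)\geq N$.
   Context: Setting: integers $w_1\geq\cdots\geq w_n\geq0$, $|\underline{w}|=w_1+\cdots+w_n$, positive integer $d$, integers $C_1\geq\cdots\geq C_n$. $\mathcal{B}$ is the multiset with $d$ balls of weight $w_i$ for each $i$. A partition $\mathcal{B}_\bullet$ is $\mathcal{B}=\mathcal{B}_1\sqcup\cdots\sqcup\mathcal{B}_n$ with each $\mathcal{B}_i$ containing exactly $d$ balls; $w(\mathcal{B}_i)$ is its total weight and $n_1(\mathcal{B}_j)$ the number of balls of weight $w_1$ in $\mathcal{B}_j$. The partition is $1$-feasible if $w(\mathcal{B}_i)\leq C_i$ for $i=2,\dots,n$; $\mathfrak{BP}(d,\underline{C};\underline{w})$ is $1$-feasible if a $1$-feasible partition exists. $W^{min}$ is the minimum of $w(\mathcal{B}_1)$ over all $1$-feasible partitions. -}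

module Defs where

open import Data.Nat using (ℕ; zero; suc; _+_; _*_; _≤_; _≡ᵇ_)
open import Data.Bool using (if_then_else_)
open import Data.Fin using (Fin; zero; suc)
open import Data.Integer using (ℤ; +_) renaming (_≤_ to _≤ℤ_)
open import Data.Product using (Σ; _×_)
open import Relation.Binary.PropositionalEquality using (_≡_)

sumF : ∀ {n} → (Fin n → ℕ) → ℕ
sumF {zero}  f = 0
sumF {suc n} f = f zero + sumF (λ i → f (suc i))

-- Ball types are indexed by i : Fin n (type i = balls of weight w i, d of each);
-- boxes B_j are indexed by j : Fin n.  Index 0 corresponds to the paper's index 1.
-- A partition B_• is described by a matrix  a j i = number of balls of type i in box B_j.
-- It is a partition of the multiset B with each box containing exactly d balls iff
-- every column sums to d and every row sums to d.
Matrix : ℕ → Set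
Matrix n = Fin n → Fin n → ℕ

IsPartition : ∀ {n} → ℕ → Matrix n → Set
IsPartition d a = (∀ i → sumF (λ j → a j i) ≡ d) × (∀ j → sumF (λ i → a j i) ≡ d)

boxWeight : ∀ {n} → (Fin n → ℕ) → Matrix n → Fin n → ℕ
boxWeight w a j = sumF (λ i → a j i * w i)

n₁ : ∀ {m} → (Fin (suc m) → ℕ) → Matrix (suc m) → Fin (suc m) → ℕ
n₁ w a j = sumF (λ i → if w i ≡ᵇ w zero then a j i else 0)

OneFeasiblePartition : ∀ {m} → ℕ → (Fin (suc m) → ℤ) → (Fin (suc m) → ℕ) → Matrix (suc m) → Set
OneFeasiblePartition {m} d C w a =
  IsPartition d a × (∀ (i : Fin m) → + boxWeight w a (suc i) ≤ℤ C (suc i))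

OneFeasible : ∀ {m} → ℕ → (Fin (suc m) → ℤ) → (Fin (suc m) → ℕ) → Set
OneFeasible d C w = Σ (Matrix _) (λ a → OneFeasiblePartition d C w a)

IsWmin : ∀ {m} → ℕ → (Fin (suc m) → ℤ) → (Fin (suc m) → ℕ) → ℕ → Set
IsWmin d C w W =
  Σ (Matrix _) (λ a → OneFeasiblePartition d C w a × boxWeight w a zero ≡ W)
  × (∀ a → OneFeasiblePartition d C w a → W ≤ boxWeight w a zero)

module Submission where

-- Start from a 1-feasible partition with w(B₁) = W^min and raise n₁(B₁) one step at a time,
-- never changing any box weight. Every other box has w(B_j) ≤ C_j ≤ C₁ < W^min, so it is strictly
-- lighter than B₁. While n₁(B₁) < N, the bound on d and pigeonhole give a box B_j holding at least
-- n₁(B₁) + n·w₁·|w| balls of weight w₁. Let X be the heaviest weight below w₁ of which B₁ holds at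
-- least w₁ balls. If B_j holds at least w₁ balls of some weight w_y < X = w_x, trade w₁ − w_y balls
-- of weight w_x from B₁ for w_x − w_y balls of weight w₁ and w₁ − w_x balls of weight w_y: no weight
-- changes and n₁(B₁) grows. Otherwise every weight B_j holds at least w₁ balls of is ≥ X, while B₁
-- holds fewer than w₁ balls of each weight in (X, w₁); counting, the surplus of weight-w₁ balls in
-- B_j outweighs this slack and makes B_j heavier than B₁, which is impossible.

open import Defs
open import Data.Nat using (ℕ; zero; suc; _+_; _*_; _∸_; _≤_; _<_; _≡ᵇ_; z≤n; _⊔_; _≤?_; _<?_)
open import Data.Nat.Properties
open import Data.Nat.Solver using (module +-*-Solver)
open import Data.Bool using (true; false; if_then_else_)
open import Data.Fin using (Fin; zero; suc) renaming (_≤_ to _≤F_)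
open import Data.Fin.Properties using (any?) renaming (_≟_ to _≟F_; suc-injective to Fin-suc-injective)
open import Data.Vec.Functional using (updateAt)
open import Data.Vec.Functional.Properties using (updateAt-updates; updateAt-minimal)
open import Data.Integer using (ℤ; +_) renaming (_≤_ to _≤ℤ_; _<_ to _<ℤ_)
import Data.Integer.Properties as ℤ
open import Data.Product using (Σ; _×_; _,_)
open import Data.Sum using (_⊎_; inj₁; inj₂)
open import Data.Empty using (⊥)
open import Function using (_∘_)
open import Relation.Nullary using (yes; no; contradiction)
open import Relation.Nullary.Decidable using (_×-dec_)
open import Relation.Unary using (Decidable)
open import Relation.Binary.PropositionalEquality
open import Algebra.Properties.CommutativeSemigroup +-commutativeSemigroup using (interchange)
open +-*-Solver using (solve; _:=_; _:+_; _:*_; con)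

sumF-cong : ∀ {n} {f g : Fin n → ℕ} → (∀ i → f i ≡ g i) → sumF f ≡ sumF g
sumF-cong {zero}  f≗g = refl
sumF-cong {suc n} f≗g = cong₂ _+_ (f≗g zero) (sumF-cong (f≗g ∘ suc))

sumF-mono : ∀ {n} {f g : Fin n → ℕ} → (∀ i → f i ≤ g i) → sumF f ≤ sumF g
sumF-mono {zero}  f≤g = z≤n
sumF-mono {suc n} f≤g = +-mono-≤ (f≤g zero) (sumF-mono (f≤g ∘ suc))

sumF-+ : ∀ {n} (f g : Fin n → ℕ) → sumF (λ i → f i + g i) ≡ sumF f + sumF g
sumF-+ {zero}  f g = refl
sumF-+ {suc n} f g = begin
  f zero + g zero + sumF (λ i → f (suc i) + g (suc i))  ≡⟨ cong (λ t → f zero + g zero + t) (sumF-+ (f ∘ suc) (g ∘ suc)) ⟩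
  f zero + g zero + (sumF (f ∘ suc) + sumF (g ∘ suc))   ≡⟨ interchange (f zero) (g zero) _ _ ⟩
  f zero + sumF (f ∘ suc) + (g zero + sumF (g ∘ suc))   ∎
  where open ≡-Reasoning

sumF-*ˡ : ∀ {n} (c : ℕ) (f : Fin n → ℕ) → sumF (λ i → c * f i) ≡ c * sumF f
sumF-*ˡ {zero}  c f = sym (*-zeroʳ c)
sumF-*ˡ {suc n} c f =
  trans (cong (λ t → c * f zero + t) (sumF-*ˡ c (f ∘ suc))) (sym (*-distribˡ-+ c (f zero) _))

sumF-*ʳ : ∀ {n} (c : ℕ) (f : Fin n → ℕ) → sumF (λ i → f i * c) ≡ sumF f * c
sumF-*ʳ c f = trans (sumF-cong (λ i → *-comm (f i) c)) (trans (sumF-*ˡ c f) (*-comm c _))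

sumF-const : ∀ n (c : ℕ) → sumF {n} (λ _ → c) ≡ n * c
sumF-const zero    c = refl
sumF-const (suc n) c = cong (λ t → c + t) (sumF-const n c)

sumF-agree-except : ∀ {n} {f g : Fin n → ℕ} (k : Fin n) →
  (∀ i → i ≢ k → f i ≡ g i) → sumF f + g k ≡ sumF g + f k
sumF-agree-except {suc n} {f} {g} zero f≈g = begin
  f zero + sumF (f ∘ suc) + g zero  ≡⟨ cong (λ t → f zero + t + g zero) (sumF-cong (λ i → f≈g (suc i) λ ())) ⟩
  f zero + sumF (g ∘ suc) + g zero  ≡⟨ solve 3 (λ a s b → a :+ s :+ b := b :+ s :+ a) refl (f zero) _ (g zero) ⟩
  g zero + sumF (g ∘ suc) + f zero  ∎
  where open ≡-Reasoning
sumF-agree-except {suc n} {f} {g} (suc k) f≈g = begin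
  f zero + sumF (f ∘ suc) + g (suc k)    ≡⟨ +-assoc (f zero) _ _ ⟩
  f zero + (sumF (f ∘ suc) + g (suc k))  ≡⟨ cong₂ _+_ (f≈g zero λ ()) (sumF-agree-except k (λ i i≢k → f≈g (suc i) (i≢k ∘ Fin-suc-injective))) ⟩
  g zero + (sumF (g ∘ suc) + f (suc k))  ≡⟨ +-assoc (g zero) _ _ ⟨
  g zero + sumF (g ∘ suc) + f (suc k)    ∎
  where open ≡-Reasoning

sumF-decrease-at : ∀ {n} {f g : Fin n → ℕ} {c : ℕ} (k : Fin n) → (∀ i → i ≢ k → f i ≡ g i) →
  f k ≡ g k ∸ c → c ≤ g k → sumF f + c ≡ sumF g
sumF-decrease-at {f = f} {g} {c} k f≈g fk c≤gk = +-cancelʳ-≡ (f k) (sumF f + c) (sumF g) (begin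
  sumF f + c + f k          ≡⟨ +-assoc (sumF f) c (f k) ⟩
  sumF f + (c + f k)        ≡⟨ cong (λ t → sumF f + (c + t)) fk ⟩
  sumF f + (c + (g k ∸ c))  ≡⟨ cong (λ t → sumF f + t) (m+[n∸m]≡n c≤gk) ⟩
  sumF f + g k              ≡⟨ sumF-agree-except k f≈g ⟩
  sumF g + f k              ∎)
  where open ≡-Reasoning

sumF-increase-at : ∀ {n} {f g : Fin n → ℕ} {c : ℕ} (k : Fin n) → (∀ i → i ≢ k → f i ≡ g i) →
  f k ≡ g k + c → sumF f ≡ sumF g + c
sumF-increase-at {f = f} {g} {c} k f≈g fk = +-cancelʳ-≡ (g k) (sumF f) (sumF g + c) (begin
  sumF f + g k        ≡⟨ sumF-agree-except k f≈g ⟩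
  sumF g + f k        ≡⟨ cong (λ t → sumF g + t) fk ⟩
  sumF g + (g k + c)  ≡⟨ cong (λ t → sumF g + t) (+-comm (g k) c) ⟩
  sumF g + (c + g k)  ≡⟨ +-assoc (sumF g) c (g k) ⟨
  sumF g + c + g k    ∎)
  where open ≡-Reasoning

rowSum : ∀ {n} → (Fin n → ℕ) → Matrix n → Fin n → ℕ
rowSum v a r = sumF (λ t → a r t * v t)

colSum : ∀ {n} → Matrix n → Fin n → ℕ
colSum a t = sumF (λ r → a r t)

adjust : ∀ {n} → Fin n → Fin n → (ℕ → ℕ) → Matrix n → Matrix n
adjust r t f a = updateAt a r (λ row → updateAt row t f)

module _ {n} (r t : Fin n) (f : ℕ → ℕ) (a : Matrix n) where

  adjust-at : adjust r t f a r t ≡ f (a r t)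
  adjust-at = trans (cong (λ row → row t) (updateAt-updates r a)) (updateAt-updates t (a r))

  adjust-other-row : ∀ {r′} → r′ ≢ r → adjust r t f a r′ ≡ a r′
  adjust-other-row {r′} r′≢r = updateAt-minimal r′ r {λ row → updateAt row t f} a r′≢r

  adjust-other : ∀ {r′ t′} → r′ ≢ r ⊎ t′ ≢ t → adjust r t f a r′ t′ ≡ a r′ t′
  adjust-other {t′ = t′} (inj₁ r′≢r) = cong (λ row → row t′) (adjust-other-row r′≢r)
  adjust-other {r′} {t′} (inj₂ t′≢t) with r′ ≟F r
  ... | yes refl = trans (cong (λ row → row t′) (updateAt-updates r a)) (updateAt-minimal t′ t (a r) t′≢t)
  ... | no r′≢r  = adjust-other (inj₁ r′≢r)

  rowSum-adjust-other : ∀ (v : Fin n → ℕ) {r′} → r′ ≢ r → rowSum v (adjust r t f a) r′ ≡ rowSum v a r′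
  rowSum-adjust-other v r′≢r = cong (λ row → sumF (λ t′ → row t′ * v t′)) (adjust-other-row r′≢r)

  colSum-adjust-other : ∀ {t′} → t′ ≢ t → colSum (adjust r t f a) t′ ≡ colSum a t′
  colSum-adjust-other t′≢t = sumF-cong (λ r′ → adjust-other {r′} (inj₂ t′≢t))

withdraw deposit : ∀ {n} → Fin n → Fin n → ℕ → Matrix n → Matrix n
withdraw r t k = adjust r t (λ x → x ∸ k)
deposit  r t k = adjust r t (λ x → x + k)

module _ {n} (r t : Fin n) (k : ℕ) (a : Matrix n) where

  rowSum-withdraw : ∀ v → k ≤ a r t → rowSum v (withdraw r t k a) r + k * v t ≡ rowSum v a r
  rowSum-withdraw v k≤a = sumF-decrease-at t
    (λ t′ t′≢t → cong (_* v t′) (adjust-other r t _ a (inj₂ t′≢t)))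
    (trans (cong (_* v t) (adjust-at r t _ a)) (*-distribʳ-∸ (v t) (a r t) k))
    (*-monoˡ-≤ (v t) k≤a)

  colSum-withdraw : k ≤ a r t → colSum (withdraw r t k a) t + k ≡ colSum a t
  colSum-withdraw = sumF-decrease-at r (λ r′ r′≢r → adjust-other r t _ a (inj₁ r′≢r)) (adjust-at r t _ a)

  rowSum-deposit : ∀ v → rowSum v (deposit r t k a) r ≡ rowSum v a r + k * v t
  rowSum-deposit v = sumF-increase-at t
    (λ t′ t′≢t → cong (_* v t′) (adjust-other r t _ a (inj₂ t′≢t)))
    (trans (cong (_* v t) (adjust-at r t _ a)) (*-distribʳ-+ (v t) (a r t) k))

  colSum-deposit : colSum (deposit r t k a) t ≡ colSum a t + k
  colSum-deposit = sumF-increase-at r (λ r′ r′≢r → adjust-other r t _ a (inj₁ r′≢r)) (adjust-at r t _ a)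

  deposit-≥ : ∀ r′ t′ → a r′ t′ ≤ deposit r t k a r′ t′
  deposit-≥ r′ t′ with r′ ≟F r | t′ ≟F t
  ... | yes refl | yes refl = ≤-trans (m≤m+n (a r t) k) (≤-reflexive (sym (adjust-at r t _ a)))
  ... | no r′≢r  | _        = ≤-reflexive (sym (adjust-other r t _ a (inj₁ r′≢r)))
  ... | _        | no t′≢t  = ≤-reflexive (sym (adjust-other r t _ a (inj₂ t′≢t)))

move : ∀ {n} → (p q i : Fin n) → ℕ → Matrix n → Matrix n
move p q i k a = deposit q i k (withdraw p i k a)

module _ {n} (p q i : Fin n) (k : ℕ) (a : Matrix n) where

  private
    a₁ : Matrix n
    a₁ = withdraw p i k a

  rowSum-move-source : ∀ v → p ≢ q → k ≤ a p i → rowSum v (move p q i k a) p + k * v i ≡ rowSum v a p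
  rowSum-move-source v p≢q k≤a =
    trans (cong (λ s → s + k * v i) (rowSum-adjust-other q i _ a₁ v p≢q)) (rowSum-withdraw p i k a v k≤a)

  rowSum-move-target : ∀ v → p ≢ q → rowSum v (move p q i k a) q ≡ rowSum v a q + k * v i
  rowSum-move-target v p≢q =
    trans (rowSum-deposit q i k a₁ v) (cong (λ s → s + k * v i) (rowSum-adjust-other p i _ a v (p≢q ∘ sym)))

  rowSum-move-other : ∀ v {r} → r ≢ p → r ≢ q → rowSum v (move p q i k a) r ≡ rowSum v a r
  rowSum-move-other v r≢p r≢q = trans (rowSum-adjust-other q i _ a₁ v r≢q) (rowSum-adjust-other p i _ a v r≢p)

  colSum-move : k ≤ a p i → ∀ t → colSum (move p q i k a) t ≡ colSum a t
  colSum-move k≤a t with t ≟F i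
  ... | yes refl = trans (colSum-deposit q i k a₁) (colSum-withdraw p i k a k≤a)
  ... | no t≢i   = trans (colSum-adjust-other q i _ a₁ t≢i) (colSum-adjust-other p i _ a t≢i)

  move-≥ : ∀ {r t} → r ≢ p ⊎ t ≢ i → a r t ≤ move p q i k a r t
  move-≥ {r} {t} away = subst (_≤ move p q i k a r t) (adjust-other p i _ a away) (deposit-≥ q i k a₁ r t)

exchange : ∀ {n} → (p q x i y : Fin n) → ℕ → ℕ → Matrix n → Matrix n
exchange p q x i y P Q a = move q p y Q (move q p i P (move p q x (P + Q) a))

module Exchange {n} {p q x i y : Fin n} {P Q : ℕ} {a : Matrix n}
         (p≢q : p ≢ q) (y≢i : y ≢ i) (P+Q≤a : P + Q ≤ a p x) (P≤a : P ≤ a q i) (Q≤a : Q ≤ a q y) where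

  private
    a₁ a₂ a₃ : Matrix n
    a₁ = move p q x (P + Q) a
    a₂ = move q p i P a₁
    a₃ = exchange p q x i y P Q a

    q≢p : q ≢ p
    q≢p = p≢q ∘ sym

    P≤a₁ : P ≤ a₁ q i
    P≤a₁ = ≤-trans P≤a (move-≥ p q x _ a (inj₁ q≢p))

    Q≤a₂ : Q ≤ a₂ q y
    Q≤a₂ = ≤-trans Q≤a (≤-trans (move-≥ p q x _ a (inj₁ q≢p)) (move-≥ q p i P a₁ (inj₂ y≢i)))

  colSum-exchange : ∀ t → colSum a₃ t ≡ colSum a t
  colSum-exchange t = trans (colSum-move q p y Q a₂ Q≤a₂ t)
    (trans (colSum-move q p i P a₁ P≤a₁ t) (colSum-move p q x _ a P+Q≤a t))

  rowSum-exchange-source : ∀ v → rowSum v a₃ p + (P + Q) * v x ≡ rowSum v a p + (P * v i + Q * v y)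
  rowSum-exchange-source v = begin
    rowSum v a₃ p + (P + Q) * v x
      ≡⟨ cong (λ s → s + (P + Q) * v x) (rowSum-move-target q p y Q a₂ v q≢p) ⟩
    rowSum v a₂ p + Q * v y + (P + Q) * v x
      ≡⟨ cong (λ s → s + Q * v y + (P + Q) * v x) (rowSum-move-target q p i P a₁ v q≢p) ⟩
    rowSum v a₁ p + P * v i + Q * v y + (P + Q) * v x
      ≡⟨ solve 4 (λ r s t u → r :+ s :+ t :+ u := r :+ u :+ (s :+ t)) refl (rowSum v a₁ p) _ _ _ ⟩
    rowSum v a₁ p + (P + Q) * v x + (P * v i + Q * v y)
      ≡⟨ cong (λ s → s + (P * v i + Q * v y)) (rowSum-move-source p q x _ a v p≢q P+Q≤a) ⟩
    rowSum v a p + (P * v i + Q * v y)  ∎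
    where open ≡-Reasoning

  rowSum-exchange-target : ∀ v → rowSum v a₃ q + (P * v i + Q * v y) ≡ rowSum v a q + (P + Q) * v x
  rowSum-exchange-target v = begin
    rowSum v a₃ q + (P * v i + Q * v y)  ≡⟨ solve 3 (λ r s t → r :+ (s :+ t) := r :+ t :+ s) refl (rowSum v a₃ q) _ _ ⟩
    rowSum v a₃ q + Q * v y + P * v i    ≡⟨ cong (λ s → s + P * v i) (rowSum-move-source q p y Q a₂ v q≢p Q≤a₂) ⟩
    rowSum v a₂ q + P * v i              ≡⟨ rowSum-move-source q p i P a₁ v q≢p P≤a₁ ⟩
    rowSum v a₁ q                        ≡⟨ rowSum-move-target p q x _ a v p≢q ⟩
    rowSum v a q + (P + Q) * v x         ∎
    where open ≡-Reasoning

  rowSum-exchange-other : ∀ v {r} → r ≢ p → r ≢ q → rowSum v a₃ r ≡ rowSum v a r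
  rowSum-exchange-other v r≢p r≢q = trans (rowSum-move-other q p y Q a₂ v r≢q r≢p)
    (trans (rowSum-move-other q p i P a₁ v r≢q r≢p) (rowSum-move-other p q x _ a v r≢p r≢q))

  rowSum-exchange-balanced : ∀ v → P * v i + Q * v y ≡ (P + Q) * v x → ∀ r → rowSum v a₃ r ≡ rowSum v a r
  rowSum-exchange-balanced v balanced r with r ≟F p | r ≟F q
  ... | yes refl | _        = +-cancelʳ-≡ _ _ _ (trans (rowSum-exchange-source v) (cong (λ s → rowSum v a r + s) balanced))
  ... | no _     | yes refl = +-cancelʳ-≡ _ _ _ (trans (rowSum-exchange-target v) (cong (λ s → rowSum v a r + s) (sym balanced)))
  ... | no r≢p   | no r≢q   = rowSum-exchange-other v r≢p r≢q

maxOver : ∀ {n} {P : Fin n → Set} → Decidable P → (Fin n → ℕ) → ℕ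
maxOver {zero}  P? f = 0
maxOver {suc n} P? f with P? zero
... | yes _ = f zero ⊔ maxOver (P? ∘ suc) (f ∘ suc)
... | no _  = maxOver (P? ∘ suc) (f ∘ suc)

maxOver-upper : ∀ {n} {P : Fin n → Set} (P? : Decidable P) (f : Fin n → ℕ) {i} → P i → f i ≤ maxOver P? f
maxOver-upper {suc n} P? f {zero} p with P? zero
... | yes _ = m≤m⊔n _ _
... | no ¬p = contradiction p ¬p
maxOver-upper {suc n} P? f {suc i} p with P? zero
... | yes _ = ≤-trans (maxOver-upper (P? ∘ suc) (f ∘ suc) p) (m≤n⊔m _ _)
... | no _  = maxOver-upper (P? ∘ suc) (f ∘ suc) p

maxOver-attained : ∀ {n} {P : Fin n → Set} (P? : Decidable P) (f : Fin n → ℕ) →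
  maxOver P? f ≡ 0 ⊎ Σ (Fin n) (λ i → P i × maxOver P? f ≡ f i)
maxOver-attained {zero}  P? f = inj₁ refl
maxOver-attained {suc n} P? f with P? zero | maxOver-attained (P? ∘ suc) (f ∘ suc)
... | yes p | rest with ⊔-sel (f zero) (maxOver (P? ∘ suc) (f ∘ suc))
...   | inj₁ max≡f0 = inj₂ (zero , p , max≡f0)
...   | inj₂ max≡rest with rest
...     | inj₁ rest≡0              = inj₁ (trans max≡rest rest≡0)
...     | inj₂ (i , pi , rest≡fi) = inj₂ (suc i , pi , trans max≡rest rest≡fi)
maxOver-attained {suc n} P? f | no _ | inj₁ rest≡0             = inj₁ rest≡0
maxOver-attained {suc n} P? f | no _ | inj₂ (i , pi , rest≡fi) = inj₂ (suc i , pi , rest≡fi)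

pigeonhole : ∀ {k} (f : Fin k → ℕ) (B : ℕ) → k * B < k + sumF f → Σ (Fin k) (λ j → B ≤ f j)
pigeonhole {suc k} f B k*B<k+Σf with B ≤? f zero
... | yes B≤f₀ = zero , B≤f₀
... | no  B≰f₀ = let j , B≤fⱼ = pigeonhole (f ∘ suc) B tail-premise in suc j , B≤fⱼ
  where
  open ≤-Reasoning
  tail-premise : k * B < k + sumF (f ∘ suc)
  tail-premise = +-cancelˡ-< B _ _ (begin-strict
    B + k * B                            <⟨ k*B<k+Σf ⟩
    suc k + (f zero + sumF (f ∘ suc))    ≡⟨ solve 3 (λ k f s → k :+ (f :+ s) := f :+ (k :+ s)) refl (suc k) (f zero) _ ⟩
    f zero + (suc k + sumF (f ∘ suc))    ≡⟨ +-suc (f zero) _ ⟩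
    suc (f zero) + (k + sumF (f ∘ suc))  ≤⟨ +-monoˡ-≤ _ (≰⇒> B≰f₀) ⟩
    B + (k + sumF (f ∘ suc))             ∎)

sumF-*ʳ-≤-weighted : ∀ {k} (r u : Fin k → ℕ) (c X : ℕ) → (∀ i → c ≤ r i → X ≤ u i) →
  sumF r * X ≤ sumF (λ i → r i * u i) + k * (c * X)
sumF-*ʳ-≤-weighted {k} r u c X heavy⇒X≤u = begin
  sumF r * X                                ≡⟨ sumF-*ʳ X r ⟨
  sumF (λ i → r i * X)                      ≤⟨ sumF-mono pointwise ⟩
  sumF (λ i → r i * u i + c * X)            ≡⟨ sumF-+ (λ i → r i * u i) (λ _ → c * X) ⟩
  sumF (λ i → r i * u i) + sumF {k} (λ _ → c * X)  ≡⟨ cong (λ s → sumF (λ i → r i * u i) + s) (sumF-const k (c * X)) ⟩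
  sumF (λ i → r i * u i) + k * (c * X)      ∎
  where
  open ≤-Reasoning
  pointwise : ∀ i → r i * X ≤ r i * u i + c * X
  pointwise i with c ≤? r i
  ... | yes c≤r = ≤-trans (*-monoʳ-≤ (r i) (heavy⇒X≤u i c≤r)) (m≤m+n _ _)
  ... | no  c≰r = ≤-trans (*-monoˡ-≤ X (<⇒≤ (≰⇒> c≰r))) (m≤n+m _ _)

if-≡ᵇ-≡ : ∀ {A : Set} {m n} {x y : A} → m ≡ n → (if m ≡ᵇ n then x else y) ≡ x
if-≡ᵇ-≡ {m = m} {n} m≡n with m ≡ᵇ n | ≡⇒≡ᵇ m n m≡n
... | true | _ = refl

if-≡ᵇ-≢ : ∀ {A : Set} {m n} {x y : A} → m ≢ n → (if m ≡ᵇ n then x else y) ≡ y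
if-≡ᵇ-≢ {m = m} {n} m≢n with m ≡ᵇ n | ≡ᵇ⇒≡ m n
... | false | _  = refl
... | true  | eq = contradiction (eq _) m≢n

module _ {m} (w : Fin (suc m) → ℕ) where

  isMax : Fin (suc m) → ℕ
  isMax i = if w i ≡ᵇ w zero then 1 else 0

  isMax-max : ∀ {i} → w i ≡ w zero → isMax i ≡ 1
  isMax-max = if-≡ᵇ-≡

  isMax-light : ∀ {i} → w i ≢ w zero → isMax i ≡ 0
  isMax-light = if-≡ᵇ-≢

  n₁≡rowSum-isMax : ∀ a j → n₁ w a j ≡ rowSum isMax a j
  n₁≡rowSum-isMax a j = sumF-cong λ i → if-as-product (w i ≡ᵇ w zero) (a j i)
    where
    if-as-product : ∀ b x → (if b then x else 0) ≡ x * (if b then 1 else 0)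
    if-as-product true  x = sym (*-identityʳ x)
    if-as-product false x = sym (*-zeroʳ x)

  n₁-all-max : (∀ i → w i ≡ w zero) → ∀ a j → n₁ w a j ≡ sumF (a j)
  n₁-all-max all-max a j = sumF-cong λ i → if-≡ᵇ-≡ {x = a j i} {0} (all-max i)

  boxWeight-upper-bound : (∀ i → w i ≤ w zero) → ∀ a j X → (∀ i → w zero ≤ a j i → w i < w zero → w i ≤ X) →
    boxWeight w a j + n₁ w a j * X ≤ n₁ w a j * w zero + sumF (a j) * X + w zero * sumF w
  boxWeight-upper-bound w≤w₀ a j X light⇒≤X = begin
    boxWeight w a j + n₁ w a j * X
      ≡⟨ cong (λ s → boxWeight w a j + s) (sumF-*ʳ X h) ⟨
    boxWeight w a j + sumF (λ i → h i * X)
      ≡⟨ sumF-+ (λ i → a j i * w i) (λ i → h i * X) ⟨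
    sumF (λ i → a j i * w i + h i * X)
      ≤⟨ sumF-mono pointwise ⟩
    sumF (λ i → h i * w zero + a j i * X + w zero * w i)
      ≡⟨ sumF-+ (λ i → h i * w zero + a j i * X) (λ i → w zero * w i) ⟩
    sumF (λ i → h i * w zero + a j i * X) + sumF (λ i → w zero * w i)
      ≡⟨ cong₂ _+_ (sumF-+ (λ i → h i * w zero) (λ i → a j i * X)) (sumF-*ˡ (w zero) w) ⟩
    sumF (λ i → h i * w zero) + sumF (λ i → a j i * X) + w zero * sumF w
      ≡⟨ cong₂ (λ s t → s + t + w zero * sumF w) (sumF-*ʳ (w zero) h) (sumF-*ʳ X (a j)) ⟩
    n₁ w a j * w zero + sumF (a j) * X + w zero * sumF w  ∎
    where
    open ≤-Reasoning
    h : Fin (suc m) → ℕ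
    h i = if w i ≡ᵇ w zero then a j i else 0
    pointwise : ∀ i → a j i * w i + h i * X ≤ h i * w zero + a j i * X + w zero * w i
    pointwise i with w i ≟ w zero
    ... | yes wᵢ≡w₀ rewrite if-≡ᵇ-≡ {x = a j i} {0} wᵢ≡w₀ | wᵢ≡w₀ = m≤m+n _ _
    ... | no  wᵢ≢w₀ rewrite if-≡ᵇ-≢ {x = a j i} {0} wᵢ≢w₀ | +-identityʳ (a j i * w i) with w zero ≤? a j i
    ...   | yes heavy = ≤-trans (*-monoʳ-≤ (a j i) (light⇒≤X i heavy (≤∧≢⇒< (w≤w₀ i) wᵢ≢w₀))) (m≤m+n _ _)
    ...   | no  light = ≤-trans (*-monoˡ-≤ (w i) (<⇒≤ (≰⇒> light))) (m≤n+m _ _)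

gap<slack : ∀ n K S R W X w₀ Z E → (n + K) * w₀ + R < W → W + n * X ≤ n * w₀ + (n + K + S) * X + Z →
  S * X ≤ R + E → K * w₀ < K * X + Z + E
gap<slack n K S R W X w₀ Z E lighter heavier S*X≤R+E = +-cancelˡ-< common _ _ (begin-strict
  common + K * w₀                                             ≡⟨ lhs ⟩
  (n + K) * w₀ + R + (W + n * X) + S * X                      <⟨ +-mono-<-≤ (+-mono-<-≤ lighter heavier) S*X≤R+E ⟩
  W + (n * w₀ + (n + K + S) * X + Z) + (R + E)                ≡⟨ rhs ⟩
  common + (K * X + Z + E)                                    ∎)
  where
  open ≤-Reasoning
  common = W + R + n * w₀ + n * X + S * X
  lhs : common + K * w₀ ≡ (n + K) * w₀ + R + (W + n * X) + S * X
  lhs = solve 7 (λ n K S R W X w₀ → W :+ R :+ n :* w₀ :+ n :* X :+ S :* X :+ K :* w₀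
                                    := (n :+ K) :* w₀ :+ R :+ (W :+ n :* X) :+ S :* X) refl n K S R W X w₀
  rhs : W + (n * w₀ + (n + K + S) * X + Z) + (R + E) ≡ common + (K * X + Z + E)
  rhs = solve 9 (λ n K S R W X w₀ Z E → W :+ (n :* w₀ :+ (n :+ K :+ S) :* X :+ Z) :+ (R :+ E)
                                        := W :+ R :+ n :* w₀ :+ n :* X :+ S :* X :+ (K :* X :+ Z :+ E)) refl n K S R W X w₀ Z E

slack≤gap : ∀ m K Z X w₀ → suc m * Z ≤ K → w₀ * X ≤ Z → X < w₀ → K * X + Z + m * (w₀ * X) ≤ K * w₀
slack≤gap m K Z X w₀ suc-m*Z≤K w₀*X≤Z X<w₀ = begin
  K * X + Z + m * (w₀ * X)  ≤⟨ +-monoʳ-≤ (K * X + Z) (*-monoʳ-≤ m w₀*X≤Z) ⟩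
  K * X + Z + m * Z         ≡⟨ +-assoc (K * X) Z (m * Z) ⟩
  K * X + suc m * Z         ≤⟨ +-monoʳ-≤ (K * X) suc-m*Z≤K ⟩
  K * X + K                 ≡⟨ solve 2 (λ K X → K :* X :+ K := K :* (X :+ con 1)) refl K X ⟩
  K * (X + 1)               ≡⟨ cong (K *_) (+-comm X 1) ⟩
  K * suc X                 ≤⟨ *-monoʳ-≤ K X<w₀ ⟩
  K * w₀                    ∎
  where open ≤-Reasoning

rowSum-ones : ∀ {n} (a : Matrix n) r → rowSum (λ _ → 1) a r ≡ sumF (a r)
rowSum-ones a r = sumF-cong λ t → *-identityʳ (a r t)

module Improvement {m : ℕ} (w : Fin (suc m) → ℕ) (C : Fin (suc m) → ℤ) (d N W : ℕ)
  (w-anti : ∀ i j → i ≤F j → w j ≤ w i) (C-anti : ∀ i j → i ≤F j → C j ≤ℤ C i)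
  (C₀<W : C zero <ℤ + W) (d-large : suc m * N + suc m * m * w zero * sumF w ≤ d) where

  w₀ Z : ℕ
  w₀ = w zero
  Z  = w₀ * sumF w

  Optimal : Matrix (suc m) → Set
  Optimal a = OneFeasiblePartition d C w a × boxWeight w a zero ≡ W

  Improvable : Matrix (suc m) → Set
  Improvable a = Σ (Matrix (suc m)) (λ a′ → Optimal a′ × n₁ w a zero < n₁ w a′ zero)

  w≤w₀ : ∀ i → w i ≤ w₀
  w≤w₀ i = w-anti zero i z≤n

  N≤d : N ≤ d
  N≤d = ≤-trans (m≤n*m N (suc m)) (≤-trans (m≤m+n _ _) d-large)

  other-box-lighter : ∀ a → Optimal a → ∀ j → boxWeight w a (suc j) < W
  other-box-lighter a ((_ , feasible) , _) j =
    ℤ.drop‿+<+ (ℤ.≤-<-trans (ℤ.≤-trans (feasible j) (C-anti zero (suc j) z≤n)) C₀<W)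

  a₀₀≤n₁ : ∀ a → a zero zero ≤ n₁ w a zero
  a₀₀≤n₁ a = subst (λ s → s ≤ n₁ w a zero) (if-≡ᵇ-≡ {m = w₀} {x = a zero zero} {0} refl) (m≤m+n _ _)

  crowded-box : ∀ a → Optimal a → n₁ w a zero < N → Σ (Fin m) (λ j → n₁ w a zero + suc m * Z ≤ a (suc j) zero)
  crowded-box a (((columns , _) , _) , _) few =
    pigeonhole (λ j → a (suc j) zero) B (≤-trans (+-cancelˡ-< n _ _ n+m*B<n+S₀) (m≤n+m S₀ m))
    where
    open ≤-Reasoning
    n B S₀ : ℕ
    n  = n₁ w a zero
    B  = n + suc m * Z
    S₀ = sumF (λ j → a (suc j) zero)
    n+m*B<n+S₀ : n + m * B < n + S₀
    n+m*B<n+S₀ = begin-strict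
      n + m * B                             <⟨ ≤-trans (m≤m+n _ m) (≤-reflexive
                                                  (solve 3 (λ m n Z → con 1 :+ (n :+ m :* (n :+ (con 1 :+ m) :* Z)) :+ m
                                                                    := (con 1 :+ m) :* (con 1 :+ n) :+ m :* ((con 1 :+ m) :* Z))
                                                         refl m n Z)) ⟩
      suc m * suc n + m * (suc m * Z)       ≤⟨ +-mono-≤ (*-monoʳ-≤ (suc m) few)
                                                  (≤-reflexive (solve 3 (λ m w₀ s → m :* ((con 1 :+ m) :* (w₀ :* s))
                                                                               := (con 1 :+ m) :* m :* w₀ :* s)
                                                                    refl m w₀ (sumF w))) ⟩
      suc m * N + suc m * m * w₀ * sumF w  ≤⟨ d-large ⟩
      d                                     ≡⟨ columns zero ⟨
      a zero zero + S₀                      ≤⟨ +-monoˡ-≤ S₀ (a₀₀≤n₁ a) ⟩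
      n + S₀                                ∎

  exchange-step : ∀ a → Optimal a → ∀ j x y → w₀ ≤ a zero x → w x < w₀ → w y < w x →
    w₀ ≤ a (suc j) zero → w₀ ≤ a (suc j) y → Improvable a
  exchange-step a (((columns , rows) , feasible) , weight₁) j x y heavy₁x x<w₀ y<x heavyⱼ₀ heavyⱼy =
    a′ , (((columns′ , rows′) , feasible′) , trans (balanced-w zero) weight₁) , n₁-grows
    where
    P Q : ℕ
    P = w x ∸ w y
    Q = w₀ ∸ w x
    a′ : Matrix (suc m)
    a′ = exchange zero (suc j) x zero y P Q a

    wx≡ : w x ≡ w y + P
    wx≡ = sym (m+[n∸m]≡n (<⇒≤ y<x))
    w₀≡ : w₀ ≡ w y + P + Q
    w₀≡ = trans (sym (m+[n∸m]≡n (<⇒≤ x<w₀))) (cong (λ s → s + Q) wx≡)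
    P+Q≤w₀ : P + Q ≤ w₀
    P+Q≤w₀ = ≤-trans (m≤n+m (P + Q) (w y)) (≤-reflexive (trans (sym (+-assoc (w y) P Q)) (sym w₀≡)))
    y≢0 : y ≢ zero
    y≢0 y≡0 = <-irrefl (cong w y≡0) (<-trans y<x x<w₀)

    open Exchange {x = x} {P = P} {Q} {a} (λ ()) y≢0 (≤-trans P+Q≤w₀ heavy₁x)
      (≤-trans (≤-trans (m≤m+n P Q) P+Q≤w₀) heavyⱼ₀) (≤-trans (≤-trans (m≤n+m Q P) P+Q≤w₀) heavyⱼy)

    balanced-w : ∀ r → boxWeight w a′ r ≡ boxWeight w a r
    balanced-w = rowSum-exchange-balanced w (begin
      P * w₀ + Q * w y              ≡⟨ cong (λ s → P * s + Q * w y) w₀≡ ⟩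
      P * (w y + P + Q) + Q * w y   ≡⟨ solve 3 (λ u P Q → P :* (u :+ P :+ Q) :+ Q :* u := (P :+ Q) :* (u :+ P)) refl (w y) P Q ⟩
      (P + Q) * (w y + P)           ≡⟨ cong (λ s → (P + Q) * s) wx≡ ⟨
      (P + Q) * w x                 ∎)
      where open ≡-Reasoning

    columns′ : ∀ t → sumF (λ r → a′ r t) ≡ d
    columns′ t = trans (colSum-exchange t) (columns t)

    rows′ : ∀ r → sumF (a′ r) ≡ d
    rows′ r = begin
      sumF (a′ r)              ≡⟨ rowSum-ones a′ r ⟨
      rowSum (λ _ → 1) a′ r    ≡⟨ rowSum-exchange-balanced (λ _ → 1) (sym (*-distribʳ-+ 1 P Q)) r ⟩
      rowSum (λ _ → 1) a r     ≡⟨ rowSum-ones a r ⟩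
      sumF (a r)               ≡⟨ rows r ⟩
      d                        ∎
      where open ≡-Reasoning

    feasible′ : ∀ i → + boxWeight w a′ (suc i) ≤ℤ C (suc i)
    feasible′ i = subst (λ s → + s ≤ℤ C (suc i)) (sym (balanced-w (suc i))) (feasible i)

    n₁-grows : n₁ w a zero < n₁ w a′ zero
    n₁-grows = begin-strict
      n₁ w a zero                                            <⟨ m<m+n _ (m<n⇒0<n∸m y<x) ⟩
      n₁ w a zero + P                                        ≡⟨ cong (λ s → s + P) (n₁≡rowSum-isMax w a zero) ⟩
      rowSum (isMax w) a zero + P                            ≡⟨ cong (λ s → rowSum (isMax w) a zero + s) gain ⟨
      rowSum (isMax w) a zero + (P * isMax w zero + Q * isMax w y)  ≡⟨ rowSum-exchange-source (isMax w) ⟨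
      rowSum (isMax w) a′ zero + (P + Q) * isMax w x         ≡⟨ cong (λ s → rowSum (isMax w) a′ zero + (P + Q) * s) (isMax-light w (<⇒≢ x<w₀)) ⟩
      rowSum (isMax w) a′ zero + (P + Q) * 0                 ≡⟨ cong (λ s → rowSum (isMax w) a′ zero + s) (*-zeroʳ (P + Q)) ⟩
      rowSum (isMax w) a′ zero + 0                           ≡⟨ +-identityʳ _ ⟩
      rowSum (isMax w) a′ zero                               ≡⟨ n₁≡rowSum-isMax w a′ zero ⟨
      n₁ w a′ zero                                           ∎
      where
      open ≤-Reasoning
      gain : P * isMax w zero + Q * isMax w y ≡ P
      gain = trans (cong₂ (λ s t → P * s + Q * t) (isMax-max w refl) (isMax-light w (<⇒≢ (<-trans y<x x<w₀))))
                   (solve 2 (λ P Q → P :* con 1 :+ Q :* con 0 := P) refl P Q)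

  no-exchange-impossible : ∀ a → Optimal a → ∀ j X → n₁ w a zero + suc m * Z ≤ a (suc j) zero → X < w₀ →
    (∀ i → w₀ ≤ a zero i → w i < w₀ → w i ≤ X) → (∀ y → w₀ ≤ a (suc j) y → X ≤ w y) → ⊥
  no-exchange-impossible a opt@(((_ , rows) , _) , weight₁) j X crowded X<w₀ light₁≤X X≤heavyⱼ =
    <-irrefl refl (<-≤-trans (gap<slack n K S R W X w₀ Z (m * (w₀ * X)) lighter box₁ boxⱼ)
                             (slack≤gap m K Z X w₀ K-large (*-monoʳ-≤ w₀ X≤Σw) X<w₀))
    where
    n K S R : ℕ
    n = n₁ w a zero
    K = a (suc j) zero ∸ n
    S = sumF (λ i → a (suc j) (suc i))
    R = sumF (λ i → a (suc j) (suc i) * w (suc i))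

    aⱼ₀≡n+K : a (suc j) zero ≡ n + K
    aⱼ₀≡n+K = sym (m+[n∸m]≡n (≤-trans (m≤m+n n _) crowded))

    K-large : suc m * Z ≤ K
    K-large = +-cancelˡ-≤ n _ _ (subst (λ s → n + suc m * Z ≤ s) aⱼ₀≡n+K crowded)

    X≤Σw : X ≤ sumF w
    X≤Σw = ≤-trans (<⇒≤ X<w₀) (m≤m+n w₀ _)

    lighter : (n + K) * w₀ + R < W
    lighter = subst (λ s → s * w₀ + R < W) aⱼ₀≡n+K (other-box-lighter a opt j)

    box₁ : W + n * X ≤ n * w₀ + (n + K + S) * X + Z
    box₁ = subst₂ (λ s t → s + n * X ≤ n * w₀ + t * X + Z) weight₁
                  (trans (rows zero) (trans (sym (rows (suc j))) (cong (λ s → s + S) aⱼ₀≡n+K)))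
                  (boxWeight-upper-bound w w≤w₀ a zero X light₁≤X)

    boxⱼ : S * X ≤ R + m * (w₀ * X)
    boxⱼ = sumF-*ʳ-≤-weighted (λ i → a (suc j) (suc i)) (w ∘ suc) w₀ X (λ i → X≤heavyⱼ (suc i))

  light₁? : ∀ (a : Matrix (suc m)) → Decidable (λ i → w₀ ≤ a zero i × w i < w₀)
  light₁? a i = (w₀ ≤? a zero i) ×-dec (w i <? w₀)

  -- 0 when box 1 holds fewer than w₀ balls of every weight below w₀.
  maxLightWeight : Matrix (suc m) → ℕ
  maxLightWeight a = maxOver (light₁? a) w

  maxLightWeight-upper : ∀ a i → w₀ ≤ a zero i → w i < w₀ → w i ≤ maxLightWeight a
  maxLightWeight-upper a i heavy light = maxOver-upper (light₁? a) w (heavy , light)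

  maxLightWeight-<w₀ : ∀ a → w₀ ≢ 0 → maxLightWeight a < w₀
  maxLightWeight-<w₀ a w₀≢0 with maxOver-attained (light₁? a) w
  ... | inj₁ X≡0                   = subst (λ s → s < w₀) (sym X≡0) (n≢0⇒n>0 w₀≢0)
  ... | inj₂ (i , (_ , light) , X≡wᵢ) = subst (λ s → s < w₀) (sym X≡wᵢ) light

  maxLightWeight-attained : ∀ a {v} → v < maxLightWeight a → Σ (Fin (suc m)) (λ x → w₀ ≤ a zero x × w x < w₀ × v < w x)
  maxLightWeight-attained a {v} v<X with maxOver-attained (light₁? a) w
  ... | inj₁ X≡0                       = contradiction (subst (λ s → v < s) X≡0 v<X) n≮0
  ... | inj₂ (x , (heavy , light) , X≡wₓ) = x , heavy , light , subst (λ s → v < s) X≡wₓ v<X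

  w₀≤Z : w₀ ≢ 0 → w₀ ≤ Z
  w₀≤Z w₀≢0 = ≤-trans (≤-reflexive (sym (*-identityʳ w₀))) (*-monoʳ-≤ w₀ (≤-trans (n≢0⇒n>0 w₀≢0) (m≤m+n w₀ _)))

  step : ∀ a → Optimal a → n₁ w a zero < N → Improvable a
  step a opt@(((_ , rows) , _) , _) few with w₀ ≟ 0
  -- With w₀ = 0 every ball has maximal weight, so already n₁(B₁) = d ≥ N.
  ... | yes w₀≡0 = contradiction (≤-trans N≤d (≤-reflexive (sym (trans (n₁-all-max w all-max a zero) (rows zero)))))
                                 (<⇒≱ few)
    where
    all-max : ∀ i → w i ≡ w₀
    all-max i = trans (n≤0⇒n≡0 (subst (λ s → w i ≤ s) w₀≡0 (w≤w₀ i))) (sym w₀≡0)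
  ... | no w₀≢0 with crowded-box a opt few
  ...   | j , crowded with any? (λ y → (w₀ ≤? a (suc j) y) ×-dec (w y <? maxLightWeight a))
  ...     | no none = contradiction (λ y heavy → ≮⇒≥ λ y<X → none (y , heavy , y<X))
                        (no-exchange-impossible a opt j (maxLightWeight a) crowded (maxLightWeight-<w₀ a w₀≢0) (maxLightWeight-upper a))
  ...     | yes (y , heavyⱼy , y<X) with maxLightWeight-attained a y<X
  ...       | x , heavy₁x , x<w₀ , y<x = exchange-step a opt j x y heavy₁x x<w₀ y<x heavyⱼ₀ heavyⱼy
    where
    heavyⱼ₀ : w₀ ≤ a (suc j) zero
    heavyⱼ₀ = ≤-trans (w₀≤Z w₀≢0) (≤-trans (m≤m+n Z (m * Z)) (≤-trans (m≤n+m _ (n₁ w a zero)) crowded))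

  improve : ∀ k a → Optimal a → N ≤ n₁ w a zero + k → Σ (Matrix (suc m)) (λ a′ → Optimal a′ × N ≤ n₁ w a′ zero)
  improve k a opt N≤n₁+k with N ≤? n₁ w a zero
  ... | yes enough = a , opt , enough
  improve zero    a opt N≤n₁+0 | no too-few = contradiction (subst (λ s → N ≤ s) (+-identityʳ _) N≤n₁+0) too-few
  improve (suc k) a opt N≤n₁+k | no too-few with step a opt (≰⇒> too-few)
  ... | a′ , opt′ , n₁<n₁′ = improve k a′ opt′ (≤-trans N≤n₁+k (≤-trans (≤-reflexive (+-suc _ k)) (+-monoˡ-≤ k n₁<n₁′)))

theorem3p1 : (m : ℕ) (w : Fin (suc m) → ℕ) (C : Fin (suc m) → ℤ) (d N : ℕ)
    → (∀ i j → i ≤F j → w j ≤ w i)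
    → (∀ i j → i ≤F j → C j ≤ℤ C i)
    → 1 ≤ d
    → 1 ≤ N
    → OneFeasible d C w
    → (W : ℕ) → IsWmin d C w W
    → C zero <ℤ + W
    → suc m * N + suc m * m * w zero * sumF w ≤ d
    → Σ (Matrix (suc m)) (λ a → OneFeasiblePartition d C w a
        × boxWeight w a zero ≡ W × N ≤ n₁ w a zero)
theorem3p1 m w C d N w-anti C-anti _ _ _ W ((a , feasible , weight₁) , _) C₀<W d-large
  with Improvement.improve w C d N W w-anti C-anti C₀<W d-large N a (feasible , weight₁) (m≤n+m N _)
... | a′ , (feasible′ , weight₁′) , N≤n₁ = a′ , feasible′ , weight₁′ , N≤n₁
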